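{- Let $G$ be any finite simple graph on $n$ vertices and let $J^*$ be the subgraph of $K_{n,n}$ with edge set $\{(i,j') : 1\le i\ne j\le n\}$. Then $\chi_\infty(G,J^*)\le n$.
   Context: Let $G$ be a simple graph with vertex set $V(G)=\{v_1,\dots,v_n\}$. Let $K_{n,n}$ be the complete bipartite graph with parts $I_n=\{1,\dots,n\}$ and $I_n'=\{1',\dots,n'\}$; a subgraph $J$ of $K_{n,n}$ with vertex set $I_n\cup I_n'$ is symmetric if $i\sim j'$ iff $j\sim i'$. The self-similar graphs based on $(G,J)$: $G^1=G$; for $k\ge2$, $V(G^k)=V(G)^k$, and $(v_{i_1},\dots,v_{i_k})\sim(v_{j_1},\dots,v_{j_k})$ in $G^k$ iff either (1) $(v_{i_1},\dots,v_{i_{k-1}})=(v_{j_1},\dots,v_{j_{k-1}})$ and $v_{i_k}\sim v_{j_k}$ in $G$, or (2) $(v_{i_1},\dots,v_{i_{k-1}})\sim(v_{j_1},\dots,v_{j_{k-1}})$ in $G^{k-1}$ and $i_k\sim j_k'$ in $J$. The sequence $\chi(G^k)$ is non-decreasing; $\chi_\infty(G,J)$ denotes its limit, with $\chi_\infty(G,J)=\infty$ if it is unbounded. -}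

module Defs where

open import Data.Nat using (ℕ; zero; suc)
open import Data.Fin using (Fin)
open import Data.Vec using (Vec; init; last)
open import Data.Product using (Σ; _×_)
open import Data.Sum using (_⊎_)
open import Relation.Binary.PropositionalEquality using (_≡_; _≢_)
open import Relation.Nullary using (¬_)

record SimpleGraph (n : ℕ) : Set₁ where
  field
    Adj   : Fin n → Fin n → Set
    sym   : ∀ {i j} → Adj i j → Adj j i
    irrefl : ∀ {i} → ¬ Adj i i

-- A subgraph J of K_{n,n} on I_n ∪ I_n' is given by its edge relation:
-- J i j  means  i ∼ j'  in J.
BipRel : ℕ → Set₁
BipRel n = Fin n → Fin n → Set

SymmetricBip : ∀ {n} → BipRel n → Set
SymmetricBip {n} J = ∀ (i j : Fin n) → (J i j → J j i) × (J j i → J i j)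

Jstar : (n : ℕ) → BipRel n
Jstar n i j = i ≢ j

-- Adjacency of the self-similar graph G^(k+1) based on (G, J); vertices are
-- (k+1)-tuples of vertices of G, i.e. Vec (Fin n) (suc k), coordinates in order
-- (v_{i_1}, …, v_{i_{k+1}}); init = first k coordinates, last = last coordinate.
PowAdj : ∀ {n} → SimpleGraph n → BipRel n → (k : ℕ) →
         Vec (Fin n) (suc k) → Vec (Fin n) (suc k) → Set
PowAdj G J zero    u v = SimpleGraph.Adj G (last u) (last v)
PowAdj G J (suc k) u v =
    (init u ≡ init v × SimpleGraph.Adj G (last u) (last v))
  ⊎ (PowAdj G J k (init u) (init v) × J (last u) (last v))

ChromaticAtMost : {V : Set} → (V → V → Set) → ℕ → Set
ChromaticAtMost {V} Adj m =
  Σ (V → Fin m) (λ c → ∀ u v → Adj u v → c u ≢ c v)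

-- χ_∞(G,J) ≤ m.  Since χ(G^k) is non-decreasing, its limit is ≤ m (in
-- particular finite) iff χ(G^k) ≤ m for every k ≥ 1; G^(k+1) ↔ PowAdj G J k.
ChiInfAtMost : ∀ {n} → SimpleGraph n → BipRel n → ℕ → Set
ChiInfAtMost G J m = ∀ (k : ℕ) → ChromaticAtMost (PowAdj G J k) m

module Submission where

-- Colour a vertex of G^k by its last coordinate. Edges of type (1) join
-- vertices whose last coordinates are adjacent in G, hence distinct; edges of
-- type (2) join vertices whose last coordinates i, j satisfy i ∼ j' in J*,
-- i.e. i ≠ j.

open import Defs
open import Data.Nat using (ℕ; zero; suc)
open import Data.Vec using (last)
open import Data.Sum using (inj₁; inj₂)
open import Data.Product using (_,_)
open import Relation.Binary.PropositionalEquality using (_≢_; refl)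

Adj⇒≢ : ∀ {n} (G : SimpleGraph n) {i j} → SimpleGraph.Adj G i j → i ≢ j
Adj⇒≢ G a refl = SimpleGraph.irrefl G a

Irreflexive : ∀ {n} → BipRel n → Set
Irreflexive J = ∀ {i j} → J i j → i ≢ j

PowAdj⇒last≢ : ∀ {n} (G : SimpleGraph n) {J : BipRel n} → Irreflexive J →
               ∀ k u v → PowAdj G J k u v → last u ≢ last v
PowAdj⇒last≢ G J-irr zero    u v a              = Adj⇒≢ G a
PowAdj⇒last≢ G J-irr (suc k) u v (inj₁ (_ , a)) = Adj⇒≢ G a
PowAdj⇒last≢ G J-irr (suc k) u v (inj₂ (_ , j)) = J-irr j

chiInf≤n-of-irreflexive : ∀ {n} (G : SimpleGraph n) {J : BipRel n} →
                          Irreflexive J → ChiInfAtMost G J n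
chiInf≤n-of-irreflexive G J-irr k = last , PowAdj⇒last≢ G J-irr k

Jstar-irreflexive : ∀ n → Irreflexive (Jstar n)
Jstar-irreflexive n i≢j = i≢j

corollary3p3 : (n : ℕ) (G : SimpleGraph n) → ChiInfAtMost G (Jstar n) n
corollary3p3 n G = chiInf≤n-of-irreflexive G (Jstar-irreflexive n)
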